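{- Let $U=(L,R;E)$ be a bipartite graph and let $M\subseteq E$ be a matching. The following are equivalent: (1) $M$ is a positive matching in $U$; (2) there exists a function $f:L\cup R\to\mathbb{R}$ such that for every edge $(\ell,r)\in E$ (with $\ell\in L$, $r\in R$), $f(\ell)>f(r)$ if and only if $(\ell,r)\in M$.
   Context: A matching $M$ in a graph $\Gamma=(V,E)$ is positive if there is a weight function $w:V\to\mathbb{R}$ such that for every edge $\{u,v\}\in E$: $w(u)+w(v)>0$ if and only if $\{u,v\}\in M$.
   Formalization: The weight function in the definition of a positive matching and the function f of condition (2) both take values in ℚ rather than ℝ. -}

module Defs where

open import Data.Empty using (⊥)
open import Data.Sum using (_⊎_; inj₁; inj₂)
open import Data.Product using (_×_; ∃)
open import Data.Rational using (ℚ; 0ℚ; _+_; _<_)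
open import Relation.Binary.PropositionalEquality using (_≡_)
open import Function.Bundles using (_⇔_)

record Graph : Set₁ where
  field
    V     : Set
    E     : V → V → Set
    E-sym : ∀ {u v} → E u v → E v u
    E-irr : ∀ {u} → E u u → ⊥
open Graph public


record IsMatching (Γ : Graph) (M : V Γ → V Γ → Set) : Set where
  field
    ⊆E     : ∀ {u v} → M u v → E Γ u v
    M-sym  : ∀ {u v} → M u v → M v u
    unique : ∀ {u v v′} → M u v → M u v′ → v ≡ v′

IsPositive : (Γ : Graph) → (V Γ → V Γ → Set) → Set
IsPositive Γ M = ∃ λ (w : V Γ → ℚ) →
  ∀ u v → E Γ u v → ((0ℚ < w u + w v) ⇔ M u v)

record BipartiteGraph : Set₁ where
  field
    L  : Set
    R  : Set
    BE : L → R → Set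
open BipartiteGraph public

record IsBipMatching (U : BipartiteGraph) (M : L U → R U → Set) : Set where
  field
    ⊆E      : ∀ {l r} → M l r → BE U l r
    uniqueR : ∀ {l r r′} → M l r → M l r′ → r ≡ r′
    uniqueL : ∀ {l l′ r} → M l r → M l′ r → l ≡ l′

data Lift {L R : Set} (P : L → R → Set) : L ⊎ R → L ⊎ R → Set where
  lr : ∀ {l r} → P l r → Lift P (inj₁ l) (inj₂ r)
  rl : ∀ {l r} → P l r → Lift P (inj₂ r) (inj₁ l)

Lift-sym : ∀ {L R : Set} {P : L → R → Set} {u v} → Lift P u v → Lift P v u
Lift-sym (lr p) = rl p
Lift-sym (rl p) = lr p

Lift-irr : ∀ {L R : Set} {P : L → R → Set} {u} → Lift P u u → ⊥
Lift-irr ()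

toGraph : BipartiteGraph → Graph
toGraph U = record
  { V = L U ⊎ R U ; E = Lift (BE U) ; E-sym = Lift-sym ; E-irr = Lift-irr }

{-# OPTIONS --safe #-}
-- Negating the weights on R turns w(l) + w(r) > 0 into w(l) > −w(r), and back;
-- and since the graph's edge relation is the symmetric lift of U's, it suffices
-- to check positivity on edges oriented from L to R.
module Submission where

open import Defs
open import Data.Product using (∃; _,_)
open import Data.Sum using (_⊎_; inj₁; inj₂)
open import Data.Rational using (ℚ; 0ℚ; _+_; -_; _-_; _<_)
open import Data.Rational.Properties using (+-monoˡ-<; +-inverseˡ; +-inverseʳ; +-comm; +-0-group)
open import Algebra.Properties.Group +-0-group using (//-rightDividesʳ)
open import Function.Bundles using (_⇔_; mk⇔)
open import Function.Construct.Composition using (_⇔-∘_)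
open import Function.Construct.Symmetry using (⇔-sym)
open import Relation.Binary.PropositionalEquality using (subst; subst₂)

+-cancelʳ-< : ∀ r {p q} → p + r < q + r → p < q
+-cancelʳ-< r {p} {q} p+r<q+r =
  subst₂ _<_ (//-rightDividesʳ r p) (//-rightDividesʳ r q) (+-monoˡ-< (- r) p+r<q+r)

+-<-translateʳ : ∀ r {p q} → (p + r < q + r) ⇔ (p < q)
+-<-translateʳ r = mk⇔ (+-cancelʳ-< r) (+-monoˡ-< r)

0<p+q⇔-q<p : ∀ p q → (0ℚ < p + q) ⇔ (- q < p)
0<p+q⇔-q<p p q = subst (λ z → (z < p + q) ⇔ (- q < p)) (+-inverseˡ q) (+-<-translateʳ q)

0<q-p⇔p<q : ∀ p q → (0ℚ < q - p) ⇔ (p < q)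
0<q-p⇔p<q p q = subst (λ z → (z < q - p) ⇔ (p < q)) (+-inverseʳ p) (+-<-translateʳ (- p))

Lift-lr⇔ : ∀ {A B : Set} {P : A → B → Set} {a b} → Lift P (inj₁ a) (inj₂ b) ⇔ P a b
Lift-lr⇔ = mk⇔ (λ { (lr p) → p }) lr

Lift-rl⇔ : ∀ {A B : Set} {P : A → B → Set} {a b} → Lift P (inj₂ b) (inj₁ a) ⇔ P a b
Lift-rl⇔ = mk⇔ (λ { (rl p) → p }) rl

negateʳ : ∀ {A B : Set} → (A ⊎ B → ℚ) → A ⊎ B → ℚ
negateʳ f (inj₁ a) = f (inj₁ a)
negateʳ f (inj₂ b) = - f (inj₂ b)

IsBipPositiveWeight : (U : BipartiteGraph) → (L U → R U → Set) → (L U ⊎ R U → ℚ) → Set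
IsBipPositiveWeight U M w =
  ∀ l r → BE U l r → (0ℚ < w (inj₁ l) + w (inj₂ r)) ⇔ M l r

IsSeparating : (U : BipartiteGraph) → (L U → R U → Set) → (L U ⊎ R U → ℚ) → Set
IsSeparating U M f =
  ∀ l r → BE U l r → (f (inj₂ r) < f (inj₁ l)) ⇔ M l r

module _ (U : BipartiteGraph) (M : L U → R U → Set) where

  isPositive⇔∃isBipPositiveWeight :
    IsPositive (toGraph U) (Lift M) ⇔ ∃ (IsBipPositiveWeight U M)
  isPositive⇔∃isBipPositiveWeight = mk⇔ restrict extend
    where
    restrict : IsPositive (toGraph U) (Lift M) → ∃ (IsBipPositiveWeight U M)
    restrict (w , pos) = w , λ l r e → Lift-lr⇔ ⇔-∘ pos (inj₁ l) (inj₂ r) (lr e)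

    extend : ∃ (IsBipPositiveWeight U M) → IsPositive (toGraph U) (Lift M)
    extend (w , pos) = w , λ where
      (inj₁ l) (inj₂ r) (lr e) → ⇔-sym Lift-lr⇔ ⇔-∘ pos l r e
      (inj₂ r) (inj₁ l) (rl e) →
        ⇔-sym Lift-rl⇔ ⇔-∘ subst (λ s → (0ℚ < s) ⇔ M l r) (+-comm (w (inj₁ l)) (w (inj₂ r))) (pos l r e)

  isBipPositiveWeight⇒isSeparating-negateʳ :
    ∀ w → IsBipPositiveWeight U M w → IsSeparating U M (negateʳ w)
  isBipPositiveWeight⇒isSeparating-negateʳ w pos l r e =
    pos l r e ⇔-∘ ⇔-sym (0<p+q⇔-q<p (w (inj₁ l)) (w (inj₂ r)))

  isSeparating⇒isBipPositiveWeight-negateʳ :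
    ∀ f → IsSeparating U M f → IsBipPositiveWeight U M (negateʳ f)
  isSeparating⇒isBipPositiveWeight-negateʳ f sep l r e =
    sep l r e ⇔-∘ 0<q-p⇔p<q (f (inj₂ r)) (f (inj₁ l))

lemma3p1 : (U : BipartiteGraph) (M : L U → R U → Set) → IsBipMatching U M →
    IsPositive (toGraph U) (Lift M)
      ⇔ (∃ λ (f : L U ⊎ R U → ℚ) →
           ∀ (l : L U) (r : R U) → BE U l r → ((f (inj₂ r) < f (inj₁ l)) ⇔ M l r))
lemma3p1 U M _ = bipartite⇔separating ⇔-∘ isPositive⇔∃isBipPositiveWeight U M
  where
  bipartite⇔separating : ∃ (IsBipPositiveWeight U M) ⇔ ∃ (IsSeparating U M)
  bipartite⇔separating = mk⇔
    (λ (w , pos) → negateʳ w , isBipPositiveWeight⇒isSeparating-negateʳ U M w pos)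
    (λ (f , sep) → negateʳ f , isSeparating⇒isBipPositiveWeight-negateʳ U M f sep)
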